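{- Consider an instance of the Linear Tape Scheduling Problem (LTSP) in which there is $k\in\mathbb{N}$ such that every file $f$ on the tape has size $s(f)=k$ and exactly one associated request ($n(f)=1$). Then the schedule associated with the empty set of mini-batches, $\mathcal{B}_1=\emptyset$ (the head moves from position $m$ directly to position $1$ and then moves rightwards to position $m$, reading every file), is an optimal schedule.
   Context: Tape model. A single-track tape stores files $f_1,\dots,f_n$ in this order from left to right; positions (blocks) are $1,\dots,m$. File $f$ occupies blocks $l(f),\dots,r(f)$, with $l(f_1)=1$, $l(f_{i+1})=r(f_i)+1$, $r(f_n)=m$; its size is $s(f)=r(f)-l(f)+1\ge 1$, so $m=\sum_i s(f_i)$. A finite set $\mathcal{R}$ of read requests is given; each request is associated with one file, and $n(f)$ is the number of requests associated with $f$. The read head is at position $m$ at time $0$ and moves along the tape at unit speed (one block per time step), possibly changing direction. A file $f$ is read when the head traverses it rightwards from $l(f)$ to $r(f)$; the time such a traversal begins is a read time of $f$. In LTSP all requests are released at time $0$; a request is serviced at the first read time of its file, and this time is its response time. LTSP asks for a head motion (schedule) minimizing the sum of all response times; such a schedule is optimal. Mini-batches. A mini-batch is a pair $b=(f,f')$ of files with $l(f)\le l(f')$; $l(b)=l(f)$, $r(b)=r(f')$. For a set $\mathcal{B}_1$ of mini-batches, the associated schedule is: starting at $m$, the head moves leftwards to position $1$; whenever it reaches for the first time the block $l(b)$ of some $b\in\mathcal{B}_1$, it moves rightwards to $r(b)$ and back to $l(b)$ (executing $b$), then continues leftwards; after reaching position $1$ it moves rightwards to $m$, reading every file. -}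

module Defs where

open import Data.Nat using (ℕ; zero; suc; _+_; _*_; _∸_; _≤_; _<_)
open import Data.Fin using (Fin; zero; suc)
open import Data.Product using (Σ; _×_)
open import Data.Sum using (_⊎_)
open import Relation.Binary.PropositionalEquality using (_≡_)
open import Relation.Nullary using (¬_)

∑ : (n : ℕ) → (Fin n → ℕ) → ℕ
∑ zero    g = 0
∑ (suc n) g = g zero + ∑ n (λ i → g (suc i))

-- A tape with n files f_0,…,f_{n-1} (in this order) is given by the sizes.
-- Coordinates: the head position is a block boundary x ∈ {0,…,m};
-- block b (1 ≤ b ≤ m) is the unit segment [b-1, b].  "Head at position m"
-- is coordinate m (right end of the tape), "position 1" / the left end is 0.
-- File i occupies the segment [lb i, lb i + s i], i.e. blocks
-- l(f) = lb i + 1, …, r(f) = lb i + s i.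

tapeLen : (n : ℕ) → (Fin n → ℕ) → ℕ
tapeLen = ∑

lb : (n : ℕ) → (Fin n → ℕ) → Fin n → ℕ
lb (suc n) s zero    = 0
lb (suc n) s (suc i) = s zero + lb n (λ j → s (suc j)) i

IsSchedule : (m L : ℕ) → (ℕ → ℕ) → Set
IsSchedule m L pos =
  (pos 0 ≡ m)
  × (∀ t → t ≤ L → pos t ≤ m)
  × (∀ t → t < L → (pos (suc t) ≡ suc (pos t)) ⊎ (suc (pos (suc t)) ≡ pos t))

IsReadTime : (n : ℕ) → (Fin n → ℕ) → (L : ℕ) → (ℕ → ℕ) → Fin n → ℕ → Set
IsReadTime n s L pos i t =
  (t + s i ≤ L) × (∀ j → j ≤ s i → pos (t + j) ≡ lb n s i + j)

IsFirstReadTime : (n : ℕ) → (Fin n → ℕ) → (L : ℕ) → (ℕ → ℕ) → Fin n → ℕ → Set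
IsFirstReadTime n s L pos i t =
  IsReadTime n s L pos i t × (∀ t′ → t′ < t → ¬ IsReadTime n s L pos i t′)

FirstReadTimes : (n : ℕ) → (Fin n → ℕ) → (L : ℕ) → (ℕ → ℕ) → (Fin n → ℕ) → Set
FirstReadTimes n s L pos T = ∀ i → IsFirstReadTime n s L pos i (T i)

-- Sum of response times: each of the nreq i requests of file i is serviced
-- at the first read time of file i (all requests released at time 0).
totalResponse : (n : ℕ) → (Fin n → ℕ) → (Fin n → ℕ) → ℕ
totalResponse n nreq T = ∑ n (λ i → nreq i * T i)

IsOptimal : (n : ℕ) → (s nreq : Fin n → ℕ) → (L : ℕ) → (ℕ → ℕ) → Set
IsOptimal n s nreq L pos =
  IsSchedule (tapeLen n s) L pos
  × Σ (Fin n → ℕ) (λ T →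
      FirstReadTimes n s L pos T
      × (∀ L′ pos′ T′ → IsSchedule (tapeLen n s) L′ pos′
           → FirstReadTimes n s L′ pos′ T′
           → totalResponse n nreq T ≤ totalResponse n nreq T′))

-- Schedule associated with the empty set of mini-batches on a tape of length m:
-- move left from m to the left end (time m), then right to m (time 2m).
emptyBatchPos : ℕ → ℕ → ℕ
emptyBatchPos m t = (m ∸ t) + (t ∸ m)

emptyBatchHorizon : ℕ → ℕ
emptyBatchHorizon m = m + m

-- Any head motion starting at the right end m satisfies  pos t + t = m + 2·R(t),
-- where R(t) is the number of rightward moves before time t.  File i (size k)
-- starts at block boundary k·i, so its first read time is T i = m + 2·R(T i) − k·i.
-- The reads of distinct files are disjoint intervals of k rightward moves each, so
-- R(T i) ≥ k·#{j : T j < T i}; summing over i, the read times being distinct,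
-- Σ R(T i) ≥ Σ k·i.  Hence Σ T i ≥ Σ (m + k·i), which is exactly the cost of the
-- schedule that sweeps left to the start and then reads the whole tape.
module Submission where

open import Defs
open import Data.Nat
open import Data.Nat.Properties
open import Algebra.Properties.CommutativeMonoid.Sum +-0-commutativeMonoid
  using (sum; sum-cong-≗)
  renaming (∑-distrib-+ to sum-distrib-+)
open import Data.Nat.Solver using (module +-*-Solver)
open import Data.Fin using (Fin; zero; suc; toℕ)
open import Data.Fin.Properties as Fin using (toℕ-injective)
open import Data.Product using (∃-syntax; _×_; _,_; proj₁; proj₂)
open import Data.Sum using (_⊎_; inj₁; inj₂)
open import Data.Empty using (⊥-elim)
open import Function using (_∘_)
open import Relation.Nullary using (¬_; Dec; yes; no; _×-dec_)
open import Relation.Binary.Definitions using (tri<; tri≈; tri>)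
open import Relation.Binary.PropositionalEquality

open +-*-Solver using (solve; _:+_; _:=_)

∑≡sum : ∀ n (f : Fin n → ℕ) → ∑ n f ≡ sum f
∑≡sum zero    f = refl
∑≡sum (suc n) f = cong (f zero +_) (∑≡sum n (λ i → f (suc i)))

∑-cong : ∀ n {f g : Fin n → ℕ} → (∀ i → f i ≡ g i) → ∑ n f ≡ ∑ n g
∑-cong n {f} {g} f≗g = trans (∑≡sum n f) (trans (sum-cong-≗ f≗g) (sym (∑≡sum n g)))

∑-distrib-+ : ∀ n (f g : Fin n → ℕ) → ∑ n (λ i → f i + g i) ≡ ∑ n f + ∑ n g
∑-distrib-+ n f g = begin
  ∑ n (λ i → f i + g i)  ≡⟨ ∑≡sum n _ ⟩
  sum (λ i → f i + g i)  ≡⟨ sum-distrib-+ f g ⟩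
  sum f + sum g          ≡⟨ cong₂ _+_ (∑≡sum n f) (∑≡sum n g) ⟨
  ∑ n f + ∑ n g          ∎
  where open ≡-Reasoning

∑-mono-≤ : ∀ n {f g : Fin n → ℕ} → (∀ i → f i ≤ g i) → ∑ n f ≤ ∑ n g
∑-mono-≤ zero    f≤g = z≤n
∑-mono-≤ (suc n) f≤g = +-mono-≤ (f≤g zero) (∑-mono-≤ n (λ i → f≤g (suc i)))

∑-const : ∀ n k → ∑ n (λ _ → k) ≡ n * k
∑-const zero    k = refl
∑-const (suc n) k = cong (k +_) (∑-const n k)

∑-zero : ∀ n {f : Fin n → ℕ} → (∀ i → f i ≡ 0) → ∑ n f ≡ 0
∑-zero n f≗0 = trans (∑-cong n f≗0) (trans (∑-const n 0) (*-zeroʳ n))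

∑-≤-singleSupport : ∀ n (f : Fin n → ℕ) s → (∀ i → f i ≤ s) →
  (∀ i j → 1 ≤ f i → 1 ≤ f j → i ≡ j) → ∑ n f ≤ s
∑-≤-singleSupport zero    f s f≤s single = z≤n
∑-≤-singleSupport (suc n) f s f≤s single with f zero in f0≡
... | zero  = ∑-≤-singleSupport n (λ i → f (suc i)) s (λ i → f≤s (suc i))
                (λ i j fi fj → Fin.suc-injective (single (suc i) (suc j) fi fj))
... | suc x = begin
  suc x + ∑ n (λ i → f (suc i))  ≡⟨ cong (suc x +_) (∑-zero n rest≡0) ⟩
  suc x + 0                      ≡⟨ +-identityʳ (suc x) ⟩
  suc x                          ≡⟨ f0≡ ⟨
  f zero                         ≤⟨ f≤s zero ⟩
  s                              ∎
  where
  open ≤-Reasoning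
  rest≡0 : ∀ i → f (suc i) ≡ 0
  rest≡0 i with f (suc i) in fi≡
  ... | zero  = refl
  ... | suc _ = ⊥-elim (Fin.0≢1+n (single zero (suc i) (positive f0≡) (positive fi≡)))
    where
    positive : ∀ {x y} → x ≡ suc y → 1 ≤ x
    positive refl = s≤s z≤n

*-+-<-mono : ∀ {k a b d} e → d < k → a < b → k * a + d < k * b + e
*-+-<-mono {k} {a} {b} {d} e d<k a<b = begin-strict
  k * a + d  <⟨ +-monoʳ-< (k * a) d<k ⟩
  k * a + k  ≡⟨ trans (+-comm (k * a) k) (sym (*-suc k a)) ⟩
  k * suc a  ≤⟨ *-monoʳ-≤ k a<b ⟩
  k * b      ≤⟨ m≤m+n (k * b) e ⟩
  k * b + e  ∎
  where open ≤-Reasoning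

quotient-unique : ∀ {k a b d e} → d < k → e < k → k * a + d ≡ k * b + e → a ≡ b
quotient-unique {a = a} {b} {d} {e} d<k e<k eq with <-cmp a b
... | tri< a<b _ _ = ⊥-elim (<-irrefl eq (*-+-<-mono e d<k a<b))
... | tri≈ _ a≡b _ = a≡b
... | tri> _ _ b<a = ⊥-elim (<-irrefl (sym eq) (*-+-<-mono d e<k b<a))

⊓-∸-saturated : ∀ {k} a b → a + k ≤ b → k ⊓ (b ∸ a) ≡ k
⊓-∸-saturated {k} a b a+k≤b = m≤n⇒m⊓n≡m (m+n≤o⇒m≤o∸n k (subst (_≤ b) (+-comm a k) a+k≤b))

⊓-∸-pair : ∀ {k} a b → a + k ≤ b ⊎ b + k ≤ a → k ≤ k ⊓ (a ∸ b) + k ⊓ (b ∸ a)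
⊓-∸-pair a b (inj₁ a+k≤b) = ≤-trans (≤-reflexive (sym (⊓-∸-saturated a b a+k≤b))) (m≤n+m _ _)
⊓-∸-pair a b (inj₂ b+k≤a) = ≤-trans (≤-reflexive (sym (⊓-∸-saturated b a b+k≤a))) (m≤m+n _ _)

⊓-∸-self : ∀ k a → k ⊓ (a ∸ a) ≡ 0
⊓-∸-self k a = trans (cong (k ⊓_) (n∸n≡0 a)) (⊓-zeroʳ k)

Separated : ∀ {n} → ℕ → (Fin n → ℕ) → Set
Separated k T = ∀ i j → i ≢ j → T i + k ≤ T j ⊎ T j + k ≤ T i

-- Each pair {i, j} of distinct indices contributes at least k to the double sum,
-- and index i is the larger one in exactly toℕ i of these pairs.
separated-∑-rank : ∀ n k (T : Fin n → ℕ) → Separated k T →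
  ∑ n (λ i → k * toℕ i) ≤ ∑ n (λ i → ∑ n (λ j → k ⊓ (T i ∸ T j)))
separated-∑-rank zero    k T sep = z≤n
separated-∑-rank (suc n) k T sep = begin
  k * 0 + ∑ n (λ i → k * suc (toℕ i))
    ≡⟨ cong₂ _+_ (*-zeroʳ k) (trans (∑-cong n (λ i → *-suc k (toℕ i))) (∑-distrib-+ n _ _)) ⟩
  ∑ n (λ _ → k) + ∑ n (λ i → k * toℕ i)
    ≤⟨ +-mono-≤ (∑-mono-≤ n (λ i → ⊓-∸-pair (T (suc i)) (T zero) (sep (suc i) zero λ ())))
                (separated-∑-rank n k (λ i → T (suc i))
                                  (λ i j i≢j → sep _ _ (i≢j ∘ Fin.suc-injective))) ⟩
  ∑ n (λ i → g (suc i) zero + g zero (suc i)) + X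
    ≡⟨ cong (_+ X) (∑-distrib-+ n _ _) ⟩
  (A + B) + X
    ≡⟨ solve 3 (λ A B X → (A :+ B) :+ X := B :+ (A :+ X)) refl A B X ⟩
  B + (A + X)
    ≡⟨ cong₂ _+_ (cong (_+ B) (sym (⊓-∸-self k (T zero)))) (sym (∑-distrib-+ n _ _)) ⟩
  (g zero zero + B) + ∑ n (λ i → g (suc i) zero + ∑ n (λ j → g (suc i) (suc j))) ∎
  where
  open ≤-Reasoning
  g : Fin (suc n) → Fin (suc n) → ℕ
  g i j = k ⊓ (T i ∸ T j)
  A = ∑ n (λ i → g (suc i) zero)
  B = ∑ n (λ j → g zero (suc j))
  X = ∑ n (λ i → ∑ n (λ j → g (suc i) (suc j)))

module RightwardMoves {m L : ℕ} {pos : ℕ → ℕ} (schedule : IsSchedule m L pos) where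

  MovesRight : ℕ → Set
  MovesRight t = pos (suc t) ≡ suc (pos t)

  rightMove : ℕ → ℕ
  rightMove t with pos (suc t) ≟ suc (pos t)
  ... | yes _ = 1
  ... | no  _ = 0

  rightMoves : ℕ → ℕ
  rightMoves zero    = 0
  rightMoves (suc t) = rightMoves t + rightMove t

  rightMove≡1 : ∀ {t} → MovesRight t → rightMove t ≡ 1
  rightMove≡1 {t} right with pos (suc t) ≟ suc (pos t)
  ... | yes _        = refl
  ... | no ¬right    = ⊥-elim (¬right right)

  rightMove≡0 : ∀ {t} → suc (pos (suc t)) ≡ pos t → rightMove t ≡ 0
  rightMove≡0 {t} left with pos (suc t) ≟ suc (pos t)
  ... | yes right = ⊥-elim (m≢1+n+m (pos t) (trans (sym left) (cong suc right)))
  ... | no _      = refl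

  move-displacement : ∀ t → t < L → suc (pos (suc t)) ≡ pos t + (rightMove t + rightMove t)
  move-displacement t t<L with proj₂ (proj₂ schedule) t t<L
  ... | inj₁ right rewrite rightMove≡1 right | right = +-comm 2 (pos t)
  ... | inj₂ left  rewrite rightMove≡0 left = trans left (sym (+-identityʳ (pos t)))

  pos+time : ∀ t → t ≤ L → pos t + t ≡ m + (rightMoves t + rightMoves t)
  pos+time zero    _     = trans (+-identityʳ (pos 0)) (trans (proj₁ schedule) (sym (+-identityʳ m)))
  pos+time (suc t) t<L = begin
    pos (suc t) + suc t                     ≡⟨ +-suc (pos (suc t)) t ⟩
    suc (pos (suc t)) + t                   ≡⟨ cong (_+ t) (move-displacement t t<L) ⟩
    pos t + (r + r) + t
      ≡⟨ solve 3 (λ p r t → p :+ (r :+ r) :+ t := p :+ t :+ (r :+ r)) refl (pos t) r t ⟩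
    pos t + t + (r + r)                     ≡⟨ cong (_+ (r + r)) (pos+time t (<⇒≤ t<L)) ⟩
    m + (R + R) + (r + r)
      ≡⟨ solve 3 (λ m R r → m :+ (R :+ R) :+ (r :+ r) := m :+ ((R :+ r) :+ (R :+ r))) refl m R r ⟩
    m + (rightMoves (suc t) + rightMoves (suc t)) ∎
    where
    open ≡-Reasoning
    r = rightMove t
    R = rightMoves t

readTime-start : ∀ {n L t} s pos i → IsReadTime n s L pos i t → pos t ≡ lb n s i
readTime-start {t = t} s pos i (_ , traverses) =
  trans (cong pos (sym (+-identityʳ t))) (trans (traverses 0 z≤n) (+-identityʳ _))

readTime-movesRight : ∀ {n L t} s pos i → 1 ≤ s i → IsReadTime n s L pos i t →
  pos (suc t) ≡ suc (pos t)
readTime-movesRight {n} {t = t} s pos i s≥1 read@(_ , traverses) = begin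
  pos (suc t)       ≡⟨ cong pos (+-comm 1 t) ⟩
  pos (t + 1)       ≡⟨ traverses 1 s≥1 ⟩
  lb n s i + 1      ≡⟨ +-comm (lb n s i) 1 ⟩
  suc (lb n s i)    ≡⟨ cong suc (readTime-start s pos i read) ⟨
  suc (pos t)       ∎
  where open ≡-Reasoning

lb-const : ∀ n k (i : Fin n) → lb n (λ _ → k) i ≡ k * toℕ i
lb-const (suc n) k zero    = sym (*-zeroʳ k)
lb-const (suc n) k (suc i) = trans (cong (k +_) (lb-const n k i)) (sym (*-suc k (toℕ i)))

module EqualSizeReads (n k : ℕ) {L : ℕ} {pos : ℕ → ℕ}
  (schedule : IsSchedule (tapeLen n (λ _ → k)) L pos)
  (T : Fin n → ℕ) (reads : ∀ i → IsReadTime n (λ _ → k) L pos i (T i)) where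

  open RightwardMoves schedule

  Reading : Fin n → ℕ → Set
  Reading i t = T i ≤ t × t < T i + k

  reading? : ∀ i t → Dec (Reading i t)
  reading? i t = T i ≤? t ×-dec t <? T i + k

  read-pos : ∀ i {δ} → δ ≤ k → pos (T i + δ) ≡ k * toℕ i + δ
  read-pos i δ≤k = trans (proj₂ (reads i) _ δ≤k) (cong (_+ _) (lb-const n k i))

  reading-offset : ∀ {i t} → Reading i t → t ∸ T i < k × T i + (t ∸ T i) ≡ t
  reading-offset {i} {t} (Tᵢ≤t , t<Tᵢ+k) =
    +-cancelˡ-< (T i) _ k (subst (_< T i + k) (sym T+δ≡t) t<Tᵢ+k) , T+δ≡t
    where
    T+δ≡t : T i + (t ∸ T i) ≡ t
    T+δ≡t = m+[n∸m]≡n Tᵢ≤t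

  reading-pos : ∀ {i t} → Reading i t → pos t ≡ k * toℕ i + (t ∸ T i)
  reading-pos {i} r with reading-offset r
  ... | δ<k , T+δ≡t = trans (cong pos (sym T+δ≡t)) (read-pos i (<⇒≤ δ<k))

  reading-movesRight : ∀ {i t} → Reading i t → MovesRight t
  reading-movesRight {i} {t} r with reading-offset r
  ... | δ<k , T+δ≡t = begin
    pos (suc t)                  ≡⟨ cong pos (trans (sym (cong suc T+δ≡t)) (sym (+-suc (T i) _))) ⟩
    pos (T i + suc (t ∸ T i))    ≡⟨ read-pos i δ<k ⟩
    k * toℕ i + suc (t ∸ T i)    ≡⟨ +-suc (k * toℕ i) _ ⟩
    suc (k * toℕ i + (t ∸ T i))  ≡⟨ cong suc (reading-pos r) ⟨
    suc (pos t)                  ∎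
    where open ≡-Reasoning

  reading-unique : ∀ {i j t} → Reading i t → Reading j t → i ≡ j
  reading-unique rᵢ rⱼ = toℕ-injective (quotient-unique
    (proj₁ (reading-offset rᵢ)) (proj₁ (reading-offset rⱼ))
    (trans (sym (reading-pos rᵢ)) (reading-pos rⱼ)))

  readTimes-overlap⇒≡ : 1 ≤ k → ∀ {i j} → T i ≤ T j → T j < T i + k → i ≡ j
  readTimes-overlap⇒≡ k≥1 {j = j} Tᵢ≤Tⱼ Tⱼ<Tᵢ+k =
    reading-unique (Tᵢ≤Tⱼ , Tⱼ<Tᵢ+k) (≤-refl , m<m+n (T j) k≥1)

  readTimes-separated : 1 ≤ k → Separated k T
  readTimes-separated k≥1 i j i≢j with T i + k ≤? T j | T j + k ≤? T i
  ... | yes i-before-j | _             = inj₁ i-before-j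
  ... | no _           | yes j-before-i = inj₂ j-before-i
  ... | no i-overlaps  | no j-overlaps with ≤-total (T i) (T j)
  ...   | inj₁ Tᵢ≤Tⱼ = ⊥-elim (i≢j (readTimes-overlap⇒≡ k≥1 Tᵢ≤Tⱼ (≰⇒> i-overlaps)))
  ...   | inj₂ Tⱼ≤Tᵢ = ⊥-elim (i≢j (sym (readTimes-overlap⇒≡ k≥1 Tⱼ≤Tᵢ (≰⇒> j-overlaps))))

  readingIndicator : Fin n → ℕ → ℕ
  readingIndicator i t with reading? i t
  ... | yes _ = 1
  ... | no  _ = 0

  readingIndicator≤rightMove : ∀ i t → readingIndicator i t ≤ rightMove t
  readingIndicator≤rightMove i t with reading? i t
  ... | yes r = ≤-reflexive (sym (rightMove≡1 (reading-movesRight r)))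
  ... | no  _ = z≤n

  readingIndicator⇒Reading : ∀ {i t} → 1 ≤ readingIndicator i t → Reading i t
  readingIndicator⇒Reading {i} {t} _  with reading? i t
  readingIndicator⇒Reading         _  | yes r = r
  readingIndicator⇒Reading         () | no  _

  readProgress : Fin n → ℕ → ℕ
  readProgress i t = k ⊓ (t ∸ T i)

  readProgress-suc : ∀ i t → readProgress i (suc t) ≤ readProgress i t + readingIndicator i t
  readProgress-suc i t with reading? i t
  ... | yes (Tᵢ≤t , _) = begin
    k ⊓ (suc t ∸ T i)    ≡⟨ cong (k ⊓_) (+-∸-assoc 1 Tᵢ≤t) ⟩
    k ⊓ suc (t ∸ T i)    ≤⟨ ⊓-mono-≤ (n≤1+n k) ≤-refl ⟩
    suc (k ⊓ (t ∸ T i))  ≡⟨ +-comm 1 _ ⟩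
    k ⊓ (t ∸ T i) + 1    ∎
    where open ≤-Reasoning
  ... | no ¬reading with T i ≤? t
  ...   | yes Tᵢ≤t = begin
    k ⊓ (suc t ∸ T i)  ≤⟨ m⊓n≤m k _ ⟩
    k                  ≡⟨ ⊓-∸-saturated (T i) t Tᵢ+k≤t ⟨
    k ⊓ (t ∸ T i)      ≡⟨ +-identityʳ _ ⟨
    k ⊓ (t ∸ T i) + 0  ∎
    where
    open ≤-Reasoning
    Tᵢ+k≤t : T i + k ≤ t
    Tᵢ+k≤t = ≮⇒≥ (λ t<Tᵢ+k → ¬reading (Tᵢ≤t , t<Tᵢ+k))
  ...   | no Tᵢ≰t rewrite m≤n⇒m∸n≡0 (≰⇒> Tᵢ≰t) | ⊓-zeroʳ k = z≤n

  ∑readProgress≤rightMoves : ∀ t → ∑ n (λ i → readProgress i t) ≤ rightMoves t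
  ∑readProgress≤rightMoves zero =
    ≤-reflexive (∑-zero n (λ i → trans (cong (k ⊓_) (0∸n≡0 (T i))) (⊓-zeroʳ k)))
  ∑readProgress≤rightMoves (suc t) = begin
    ∑ n (λ i → readProgress i (suc t))
      ≤⟨ ∑-mono-≤ n (λ i → readProgress-suc i t) ⟩
    ∑ n (λ i → readProgress i t + readingIndicator i t)
      ≡⟨ ∑-distrib-+ n _ _ ⟩
    ∑ n (λ i → readProgress i t) + ∑ n (λ i → readingIndicator i t)
      ≤⟨ +-mono-≤ (∑readProgress≤rightMoves t) (∑-≤-singleSupport n _ _
           (λ i → readingIndicator≤rightMove i t)
           (λ i j onᵢ onⱼ → reading-unique (readingIndicator⇒Reading onᵢ)
                                           (readingIndicator⇒Reading onⱼ))) ⟩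
    rightMoves t + rightMove t
      ∎
    where open ≤-Reasoning

  m : ℕ
  m = tapeLen n (λ _ → k)

  readTime-identity : ∀ i → T i + k * toℕ i ≡ m + (rightMoves (T i) + rightMoves (T i))
  readTime-identity i = begin
    T i + k * toℕ i  ≡⟨ +-comm (T i) _ ⟩
    k * toℕ i + T i  ≡⟨ cong (_+ T i) (trans (readTime-start _ pos i (reads i)) (lb-const n k i)) ⟨
    pos (T i) + T i  ≡⟨ pos+time (T i) (m+n≤o⇒m≤o (T i) (proj₁ (reads i))) ⟩
    m + (rightMoves (T i) + rightMoves (T i)) ∎
    where open ≡-Reasoning

  ∑rank≤∑rightMoves : 1 ≤ k → ∑ n (λ i → k * toℕ i) ≤ ∑ n (λ i → rightMoves (T i))
  ∑rank≤∑rightMoves k≥1 = begin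
    ∑ n (λ i → k * toℕ i)
      ≤⟨ separated-∑-rank n k T (readTimes-separated k≥1) ⟩
    ∑ n (λ i → ∑ n (λ j → readProgress j (T i)))
      ≤⟨ ∑-mono-≤ n (λ i → ∑readProgress≤rightMoves (T i)) ⟩
    ∑ n (λ i → rightMoves (T i))
      ∎
    where open ≤-Reasoning

  ∑readTimes-lowerBound : 1 ≤ k → ∑ n (λ i → m + k * toℕ i) ≤ ∑ n T
  ∑readTimes-lowerBound k≥1 = +-cancelʳ-≤ A _ _ (begin
    ∑ n (λ i → m + a i) + A  ≡⟨ cong (_+ A) (∑-distrib-+ n _ a) ⟩
    M + A + A                ≡⟨ +-assoc M A A ⟩
    M + (A + A)              ≤⟨ +-monoʳ-≤ M (+-mono-≤ A≤R A≤R) ⟩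
    M + (R + R)              ≡⟨ ∑T+A ⟨
    ∑ n T + A                ∎)
    where
    open ≤-Reasoning
    a r : Fin n → ℕ
    a i = k * toℕ i
    r i = rightMoves (T i)
    A = ∑ n a
    R = ∑ n r
    M = ∑ n (λ _ → m)
    A≤R : A ≤ R
    A≤R = ∑rank≤∑rightMoves k≥1
    ∑T+A : ∑ n T + A ≡ M + (R + R)
    ∑T+A = trans (sym (∑-distrib-+ n T a)) (trans (∑-cong n readTime-identity)
             (trans (∑-distrib-+ n _ _) (cong (M +_) (∑-distrib-+ n r r))))

lb+size≤tapeLen : ∀ n (s : Fin n → ℕ) i → lb n s i + s i ≤ tapeLen n s
lb+size≤tapeLen (suc n) s zero    = m≤m+n (s zero) _
lb+size≤tapeLen (suc n) s (suc i) = begin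
  s zero + lb n (λ j → s (suc j)) i + s (suc i)   ≡⟨ +-assoc (s zero) _ _ ⟩
  s zero + (lb n (λ j → s (suc j)) i + s (suc i))
    ≤⟨ +-monoʳ-≤ (s zero) (lb+size≤tapeLen n (λ j → s (suc j)) i) ⟩
  s zero + tapeLen n (λ j → s (suc j))
    ∎
  where open ≤-Reasoning

before-or-after : ∀ m t → t < m ⊎ ∃[ u ] m + u ≡ t
before-or-after m t with t <? m
... | yes t<m = inj₁ t<m
... | no  t≮m = inj₂ (m≤n⇒∃[o]m+o≡n (≮⇒≥ t≮m))

emptyBatchPos-before : ∀ {m t} → t ≤ m → emptyBatchPos m t ≡ m ∸ t
emptyBatchPos-before {m} {t} t≤m rewrite m≤n⇒m∸n≡0 t≤m = +-identityʳ (m ∸ t)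

emptyBatchPos-after : ∀ m u → emptyBatchPos m (m + u) ≡ u
emptyBatchPos-after m u rewrite m≤n⇒m∸n≡0 (m≤m+n m u) | m+n∸m≡n m u = refl

emptyBatch-movesLeft : ∀ {m t} → t < m → suc (emptyBatchPos m (suc t)) ≡ emptyBatchPos m t
emptyBatch-movesLeft {m} {t} t<m = begin
  suc (emptyBatchPos m (suc t))  ≡⟨ cong suc (emptyBatchPos-before t<m) ⟩
  suc (m ∸ suc t)                ≡⟨ +-∸-assoc 1 t<m ⟨
  m ∸ t                          ≡⟨ emptyBatchPos-before (<⇒≤ t<m) ⟨
  emptyBatchPos m t              ∎
  where open ≡-Reasoning

emptyBatch-movesRight : ∀ m u → emptyBatchPos m (suc (m + u)) ≡ suc (emptyBatchPos m (m + u))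
emptyBatch-movesRight m u = begin
  emptyBatchPos m (suc (m + u))  ≡⟨ cong (emptyBatchPos m) (+-suc m u) ⟨
  emptyBatchPos m (m + suc u)    ≡⟨ emptyBatchPos-after m (suc u) ⟩
  suc u                          ≡⟨ cong suc (emptyBatchPos-after m u) ⟨
  suc (emptyBatchPos m (m + u))  ∎
  where open ≡-Reasoning

emptyBatch-isSchedule : ∀ m → IsSchedule m (emptyBatchHorizon m) (emptyBatchPos m)
emptyBatch-isSchedule m = emptyBatchPos-before z≤n , onTape , unitSteps
  where
  onTape : ∀ t → t ≤ m + m → emptyBatchPos m t ≤ m
  onTape t t≤2m with before-or-after m t
  ... | inj₁ t<m       = subst (_≤ m) (sym (emptyBatchPos-before (<⇒≤ t<m))) (m∸n≤m m t)
  ... | inj₂ (u , refl) = subst (_≤ m) (sym (emptyBatchPos-after m u)) (+-cancelˡ-≤ m u m t≤2m)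
  unitSteps : ∀ t → t < m + m →
    (emptyBatchPos m (suc t) ≡ suc (emptyBatchPos m t))
    ⊎ (suc (emptyBatchPos m (suc t)) ≡ emptyBatchPos m t)
  unitSteps t _ with before-or-after m t
  ... | inj₁ t<m       = inj₂ (emptyBatch-movesLeft t<m)
  ... | inj₂ (u , refl) = inj₁ (emptyBatch-movesRight m u)

emptyBatch-firstReads : ∀ n (s : Fin n → ℕ) → (∀ i → 1 ≤ s i) →
  FirstReadTimes n s (emptyBatchHorizon (tapeLen n s)) (emptyBatchPos (tapeLen n s))
    (λ i → tapeLen n s + lb n s i)
emptyBatch-firstReads n s s≥1 i = readsAt-lb , noEarlierRead
  where
  m = tapeLen n s
  L = emptyBatchHorizon m
  pos = emptyBatchPos m
  readsAt-lb : IsReadTime n s L pos i (m + lb n s i)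
  readsAt-lb = subst (_≤ m + m) (sym (+-assoc m _ _)) (+-monoʳ-≤ m (lb+size≤tapeLen n s i))
             , λ j _ → trans (cong pos (+-assoc m _ j)) (emptyBatchPos-after m _)
  noEarlierRead : ∀ t → t < m + lb n s i → ¬ IsReadTime n s L pos i t
  noEarlierRead t t<read read with before-or-after m t
  ... | inj₁ t<m = m≢1+n+m (pos t) {1}
    (trans (sym (emptyBatch-movesLeft t<m)) (cong suc (readTime-movesRight s pos i (s≥1 i) read)))
  ... | inj₂ (u , refl) = <-irrefl (cong (m +_) u≡lb) t<read
    where
    u≡lb : u ≡ lb n s i
    u≡lb = trans (sym (emptyBatchPos-after m u)) (readTime-start s pos i read)

open EqualSizeReads using (∑readTimes-lowerBound)

theorem1 : (n k : ℕ) → 1 ≤ k →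
    IsOptimal n (λ _ → k) (λ _ → 1)
      (emptyBatchHorizon (tapeLen n (λ _ → k)))
      (emptyBatchPos (tapeLen n (λ _ → k)))
theorem1 n k k≥1 =
  emptyBatch-isSchedule m , (λ i → m + lb n (λ _ → k) i) ,
  emptyBatch-firstReads n (λ _ → k) (λ _ → k≥1) , optimal
  where
  m = tapeLen n (λ _ → k)
  optimal : ∀ L pos T → IsSchedule m L pos → FirstReadTimes n (λ _ → k) L pos T →
    totalResponse n (λ _ → 1) (λ i → m + lb n (λ _ → k) i) ≤ totalResponse n (λ _ → 1) T
  optimal L pos T schedule firstReads = begin
    ∑ n (λ i → 1 * (m + lb n (λ _ → k) i))
      ≡⟨ ∑-cong n (λ i → trans (*-identityˡ _) (cong (m +_) (lb-const n k i))) ⟩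
    ∑ n (λ i → m + k * toℕ i)
      ≤⟨ ∑readTimes-lowerBound n k schedule T (proj₁ ∘ firstReads) k≥1 ⟩
    ∑ n T
      ≡⟨ ∑-cong n (λ i → *-identityˡ (T i)) ⟨
    ∑ n (λ i → 1 * T i)
      ∎
    where open ≤-Reasoning
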